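{- For all $w\in F_2$, $\pi(\mathrm{Pal}(w))=(M_w-I_2)\begin{pmatrix}1\\1\end{pmatrix}$.
   Context: $F_2$ is the free group on $a,b$. $w\mapsto R_w$ is the group homomorphism $F_2\to\mathrm{Aut}(F_2)$ with $R_a(a)=a$, $R_a(b)=ba$, $R_b(a)=ab$, $R_b(b)=b$. The palindromization map $\mathrm{Pal}:F_2\to F_2$ is defined by $\mathrm{Pal}(w)=b^{ -1}a^{ -1}R_w(ab)$. $\pi:F_2\to\mathbb{Z}^2$ is the abelianization homomorphism sending $a$ to $(1,0)^T$ and $b$ to $(0,1)^T$. For $w\in F_2$, $M_w\in GL_2(\mathbb{Z})$ is the unique matrix with $\pi\circ R_w=M_w\circ\pi$; $I_2$ is the $2\times2$ identity matrix. -}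

module Defs where

open import Data.List using (List; []; _∷_; _++_; reverse; map; concatMap)
open import Data.Integer using (ℤ; +_; -[1+_]; _+_; _-_; _*_)
open import Data.Vec using (Vec; []; _∷_)

data Gen : Set where
  a b : Gen

data Letter : Set where
  pos : Gen → Letter
  neg : Gen → Letter

-- Elements of F₂ are represented by (not necessarily reduced) words;
-- the group product is concatenation and all maps below respect free
-- reduction, so they are well defined on F₂.
Word : Set
Word = List Letter

A B A⁻¹ B⁻¹ : Letter
A = pos a
B = pos b
A⁻¹ = neg a
B⁻¹ = neg b

invL : Letter → Letter
invL (pos x) = neg x
invL (neg x) = pos x

inv : Word → Word
inv w = reverse (map invL w)

extend : (Gen → Word) → Word → Word
extend f [] = []
extend f (pos x ∷ w) = f x ++ extend f w
extend f (neg x ∷ w) = inv (f x) ++ extend f w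

-- R_a, R_b and their inverses (R_{a⁻¹} = R_a⁻¹, R_{b⁻¹} = R_b⁻¹).
-- R_a(a)=a, R_a(b)=ba ; R_a⁻¹(a)=a, R_a⁻¹(b)=ba⁻¹
-- R_b(a)=ab, R_b(b)=b ; R_b⁻¹(a)=ab⁻¹, R_b⁻¹(b)=b
genImage : Letter → Gen → Word
genImage (pos a) a = A ∷ []
genImage (pos a) b = B ∷ A ∷ []
genImage (neg a) a = A ∷ []
genImage (neg a) b = B ∷ A⁻¹ ∷ []
genImage (pos b) a = A ∷ B ∷ []
genImage (pos b) b = B ∷ []
genImage (neg b) a = A ∷ B⁻¹ ∷ []
genImage (neg b) b = B ∷ []

R : Word → Word → Word
R [] u = u
R (x ∷ w) u = extend (genImage x) (R w u)

Pal : Word → Word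
Pal w = B⁻¹ ∷ A⁻¹ ∷ R w (A ∷ B ∷ [])

Vec2 : Set
Vec2 = Vec ℤ 2

_⊕_ : Vec2 → Vec2 → Vec2
(x ∷ y ∷ []) ⊕ (x' ∷ y' ∷ []) = (x + x') ∷ (y + y') ∷ []

πL : Letter → Vec2
πL (pos a) = + 1 ∷ + 0 ∷ []
πL (pos b) = + 0 ∷ + 1 ∷ []
πL (neg a) = -[1+ 0 ] ∷ + 0 ∷ []
πL (neg b) = + 0 ∷ -[1+ 0 ] ∷ []

π : Word → Vec2
π [] = + 0 ∷ + 0 ∷ []
π (x ∷ w) = πL x ⊕ π w

-- 2×2 integer matrices, as a vector of rows.
Mat2 : Set
Mat2 = Vec (Vec ℤ 2) 2

-- M_w: the unique matrix with π ∘ R_w = M_w ∘ π.  Since π is a surjective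
-- homomorphism and a,b map to the standard basis, its j-th column is
-- π(R_w(e_j)) with e_1 = a, e_2 = b.
M : Word → Mat2
M w with π (R w (A ∷ [])) | π (R w (B ∷ []))
... | p ∷ q ∷ [] | r ∷ s ∷ [] = (p ∷ r ∷ []) ∷ (q ∷ s ∷ []) ∷ []

I₂ : Mat2
I₂ = (+ 1 ∷ + 0 ∷ []) ∷ (+ 0 ∷ + 1 ∷ []) ∷ []

_-ₘ_ : Mat2 → Mat2 → Mat2
((p ∷ r ∷ []) ∷ (q ∷ s ∷ []) ∷ []) -ₘ ((p' ∷ r' ∷ []) ∷ (q' ∷ s' ∷ []) ∷ []) =
  ((p - p') ∷ (r - r') ∷ []) ∷ ((q - q') ∷ (s - s') ∷ []) ∷ []

_·_ : Mat2 → Vec2 → Vec2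
((p ∷ r ∷ []) ∷ (q ∷ s ∷ []) ∷ []) · (x ∷ y ∷ []) =
  (p * x + r * y) ∷ (q * x + s * y) ∷ []

one-one : Vec2
one-one = + 1 ∷ + 1 ∷ []

module Submission where

-- Pal(w) = b⁻¹a⁻¹·R_w(ab), and R_w is an endomorphism of F₂,
-- so R_w(ab) = R_w(a)·R_w(b).  Applying the abelianization π (which turns
-- products into sums) gives
--   π(Pal w) = π(b⁻¹) + π(a⁻¹) + π(R_w a) + π(R_w b).
-- The columns of M_w are exactly π(R_w a) and π(R_w b), so the right-hand
-- side is (first column of M_w) + (second column of M_w) - (1,1)ᵀ, which is
-- (M_w - I₂)(1,1)ᵀ.

open import Defs
open import Relation.Binary.PropositionalEquality
  using (_≡_; refl; cong; cong₂; sym; module ≡-Reasoning)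
open import Data.List using ([]; _∷_; _++_)
open import Data.List.Properties using (++-assoc)
open import Data.Vec using ([]; _∷_)
open import Data.Integer using (+_; -[1+_]; _+_; _-_; _*_)
import Data.Integer.Properties as ℤ
open import Data.Integer.Tactic.RingSolver using (solve-∀)

open ≡-Reasoning

prefix-step : ∀ f p u v → extend f (u ++ v) ≡ extend f u ++ extend f v →
  p ++ extend f (u ++ v) ≡ (p ++ extend f u) ++ extend f v
prefix-step f p u v split = begin
  p ++ extend f (u ++ v)               ≡⟨ cong (p ++_) split ⟩
  p ++ (extend f u ++ extend f v)      ≡⟨ sym (++-assoc p (extend f u) (extend f v)) ⟩
  (p ++ extend f u) ++ extend f v      ∎

extend-++ : ∀ f u v → extend f (u ++ v) ≡ extend f u ++ extend f v
extend-++ f []          v = refl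
extend-++ f (pos x ∷ u) v = prefix-step f (f x) u v (extend-++ f u v)
extend-++ f (neg x ∷ u) v = prefix-step f (inv (f x)) u v (extend-++ f u v)

R-++ : ∀ w u v → R w (u ++ v) ≡ R w u ++ R w v
R-++ []      u v = refl
R-++ (x ∷ w) u v = begin
  extend (genImage x) (R w (u ++ v))                      ≡⟨ cong (extend (genImage x)) (R-++ w u v) ⟩
  extend (genImage x) (R w u ++ R w v)                    ≡⟨ extend-++ (genImage x) (R w u) (R w v) ⟩
  extend (genImage x) (R w u) ++ extend (genImage x) (R w v) ∎

⊕-assoc : ∀ x y z → (x ⊕ y) ⊕ z ≡ x ⊕ (y ⊕ z)
⊕-assoc (x₁ ∷ x₂ ∷ []) (y₁ ∷ y₂ ∷ []) (z₁ ∷ z₂ ∷ []) =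
  cong₂ (λ p q → p ∷ q ∷ []) (ℤ.+-assoc x₁ y₁ z₁) (ℤ.+-assoc x₂ y₂ z₂)

⊕-identityˡ : ∀ z → (+ 0 ∷ + 0 ∷ []) ⊕ z ≡ z
⊕-identityˡ (z₁ ∷ z₂ ∷ []) =
  cong₂ (λ p q → p ∷ q ∷ []) (ℤ.+-identityˡ z₁) (ℤ.+-identityˡ z₂)

π-++ : ∀ u v → π (u ++ v) ≡ π u ⊕ π v
π-++ []      v = sym (⊕-identityˡ (π v))
π-++ (l ∷ u) v = begin
  πL l ⊕ π (u ++ v)     ≡⟨ cong (πL l ⊕_) (π-++ u v) ⟩
  πL l ⊕ (π u ⊕ π v)    ≡⟨ sym (⊕-assoc (πL l) (π u) (π v)) ⟩
  (πL l ⊕ π u) ⊕ π v    ∎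

π-R-ab : ∀ w → π (R w (A ∷ B ∷ [])) ≡ π (R w (A ∷ [])) ⊕ π (R w (B ∷ []))
π-R-ab w = begin
  π (R w (A ∷ [] ++ B ∷ []))              ≡⟨ cong π (R-++ w (A ∷ []) (B ∷ [])) ⟩
  π (R w (A ∷ []) ++ R w (B ∷ []))        ≡⟨ π-++ (R w (A ∷ [])) (R w (B ∷ [])) ⟩
  π (R w (A ∷ [])) ⊕ π (R w (B ∷ []))     ∎

columns : Vec2 → Vec2 → Mat2
columns (p ∷ q ∷ []) (r ∷ s ∷ []) = (p ∷ r ∷ []) ∷ (q ∷ s ∷ []) ∷ []

columns-sum : ∀ c₁ c₂ →
  πL B⁻¹ ⊕ (πL A⁻¹ ⊕ (c₁ ⊕ c₂)) ≡ (columns c₁ c₂ -ₘ I₂) · one-one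
columns-sum (p ∷ q ∷ []) (r ∷ s ∷ []) =
  cong₂ (λ x y → x ∷ y ∷ []) (first-row p r) (second-row q s)
  where
    first-row : ∀ p r → + 0 + (-[1+ 0 ] + (p + r)) ≡ (p - + 1) * + 1 + (r - + 0) * + 1
    first-row = solve-∀
    second-row : ∀ q s → -[1+ 0 ] + (+ 0 + (q + s)) ≡ (q - + 0) * + 1 + (s - + 1) * + 1
    second-row = solve-∀

M-columns : ∀ w → M w ≡ columns (π (R w (A ∷ []))) (π (R w (B ∷ [])))
M-columns w with π (R w (A ∷ [])) | π (R w (B ∷ []))
... | _ ∷ _ ∷ [] | _ ∷ _ ∷ [] = refl

proposition4p5 : (w : Word) → π (Pal w) ≡ (M w -ₘ I₂) · one-one
proposition4p5 w = begin
  πL B⁻¹ ⊕ (πL A⁻¹ ⊕ π (R w (A ∷ B ∷ [])))  ≡⟨ cong (λ v → πL B⁻¹ ⊕ (πL A⁻¹ ⊕ v)) (π-R-ab w) ⟩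
  πL B⁻¹ ⊕ (πL A⁻¹ ⊕ (cₐ ⊕ c_b))            ≡⟨ columns-sum cₐ c_b ⟩
  (columns cₐ c_b -ₘ I₂) · one-one          ≡⟨ cong (λ N → (N -ₘ I₂) · one-one) (sym (M-columns w)) ⟩
  (M w -ₘ I₂) · one-one                     ∎
  where
    cₐ c_b : Vec2
    cₐ  = π (R w (A ∷ []))
    c_b = π (R w (B ∷ []))
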